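{- An involution-free graph with at least two vertices but at most one even-degree vertex contains a cycle.
   Context: Graphs are finite, simple, undirected, loopless. A graph is involution-free if it has no automorphism $\rho\neq\mathrm{id}$ with $\rho^2=\mathrm{id}$. Degree $0$ counts as even. -}

module Defs where

open import Data.Nat using (ℕ; zero; suc; _+_; _%_; _≤_)
open import Data.Bool using (Bool; true; false; if_then_else_)
open import Data.Fin using (Fin; inject₁; fromℕ) renaming (zero to fzero; suc to fsuc)
open import Data.Fin.Permutation using (Permutation′; _⟨$⟩ʳ_)
open import Data.List using (List; map; allFin)
open import Data.Nat.ListAction using (sum)
open import Data.Empty using (⊥)
open import Data.Product using (Σ; ∃; _×_)
open import Function.Definitions using (Injective)
open import Relation.Binary.PropositionalEquality using (_≡_; _≢_)

record Graph (n : ℕ) : Set where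
  field
    adj   : Fin n → Fin n → Bool
    sym   : ∀ u v → adj u v ≡ adj v u
    loopless : ∀ v → adj v v ≡ false
open Graph public

degree : ∀ {n} → Graph n → Fin n → ℕ
degree {n} G v = sum (map (λ u → if adj G v u then 1 else 0) (allFin n))

EvenDegree : ∀ {n} → Graph n → Fin n → Set
EvenDegree G v = degree G v % 2 ≡ 0

IsAutomorphism : ∀ {n} → Graph n → Permutation′ n → Set
IsAutomorphism G ρ = ∀ u v → adj G (ρ ⟨$⟩ʳ u) (ρ ⟨$⟩ʳ v) ≡ adj G u v

IsInvolution : ∀ {n} → Graph n → Permutation′ n → Set
IsInvolution G ρ =
  IsAutomorphism G ρ × (∀ v → ρ ⟨$⟩ʳ (ρ ⟨$⟩ʳ v) ≡ v) × ∃ (λ v → ρ ⟨$⟩ʳ v ≢ v)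

InvolutionFree : ∀ {n} → Graph n → Set
InvolutionFree {n} G = (ρ : Permutation′ n) → IsInvolution G ρ → ⊥

record Cycle {n : ℕ} (G : Graph n) : Set where
  field
    len-3 : ℕ
    vtx   : Fin (suc (suc (suc len-3))) → Fin n
    distinct : Injective _≡_ _≡_ vtx
    step  : ∀ (i : Fin (suc (suc len-3))) → adj G (vtx (inject₁ i)) (vtx (fsuc i)) ≡ true
    close : adj G (vtx (fromℕ (suc (suc len-3)))) (vtx fzero) ≡ true

HasCycle : ∀ {n} → Graph n → Set
HasCycle G = Cycle G

-- Take a path v₀ v₁ … v_k that cannot be improved at either end: no neighbour u ≠ v₂ of v₁ has a
-- neighbour other than v₁ (otherwise there is a longer path, or a cycle). Then all neighbours of v₁
-- except v₂ are leaves. Swapping two leaves at a common vertex is an involutive automorphism, so v₁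
-- has exactly the neighbours v₀ and v₂ and thus even degree, and likewise v_{k-1}. For k ≥ 3 these are
-- two distinct even vertices; for k = 2 the ends v₀ and v₂ are twin leaves. Short paths are handled
-- alike: two isolated vertices are both even, and the ends of an isolated edge are swapped.
module Submission where

open import Defs hiding (sym)
open import Data.Nat.Properties using (≤⇒≯; m≤m+n; +-suc; +-commutativeSemigroup)
open import Algebra.Properties.CommutativeSemigroup +-commutativeSemigroup using (interchange)
open import Data.Bool using (Bool; true; false; if_then_else_)
import Data.Bool.Properties as Bool
open import Data.Empty using (⊥; ⊥-elim)
open import Data.Fin using (Fin; toℕ; inject₁; inject≤; fromℕ; opposite) renaming (suc to fsuc)
open import Data.Fin.Patterns using (0F; 1F; 2F)
open import Data.Fin.Permutation using (transpose)
import Data.Fin.Permutation.Components as PC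
open import Data.Fin.Properties
  using (_≟_; any?; toℕ-injective; toℕ-inject≤; toℕ-inject₁; toℕ-fromℕ; toℕ<n; inject≤-injective;
         opposite-involutive; injective⇒≤; suc-injective)
open import Data.List using (map; allFin)
open import Data.List.Properties using (map-tabulate)
open import Data.Nat using (ℕ; zero; suc; _+_; _≤_; _<_; _%_; s≤s; s≤s⁻¹)
open import Data.Nat.ListAction using (sum)
open import Data.Product using (∃; _,_)
open import Data.Sum using (_⊎_; inj₁; inj₂)
open import Function using (_∘_; id)
open import Function.Definitions using (Injective)
open import Relation.Nullary using (Dec; yes; no; ¬?; _×-dec_; does)
open import Relation.Nullary.Decidable using (dec-false; decidable-stable)
open import Relation.Binary.PropositionalEquality
  using (_≡_; _≢_; refl; sym; trans; cong; cong₂; subst; module ≡-Reasoning)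

indicator : Bool → ℕ
indicator b = if b then 1 else 0

count : ∀ {m} → (Fin m → Bool) → ℕ
count {m} g = sum (map (indicator ∘ g) (allFin m))

count-suc : ∀ {m} (g : Fin (suc m) → Bool) → count g ≡ indicator (g 0F) + count (g ∘ fsuc)
count-suc {m} g = cong (λ xs → indicator (g 0F) + sum xs)
  (trans (map-tabulate fsuc (indicator ∘ g)) (sym (map-tabulate id (indicator ∘ g ∘ fsuc))))

count-none : ∀ {m} (g : Fin m → Bool) → (∀ u → g u ≡ false) → count g ≡ 0
count-none {zero} g none = refl
count-none {suc m} g none =
  trans (count-suc g) (cong₂ _+_ (cong indicator (none 0F)) (count-none (g ∘ fsuc) (none ∘ fsuc)))

count-singleton : ∀ {m} (y : Fin m) → count (λ u → does (u ≟ y)) ≡ 1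
count-singleton {suc m} 0F =
  trans (count-suc {m} (λ u → does (u ≟ 0F)))
        (cong suc (count-none {m} (λ u → does (fsuc u ≟ 0F)) (λ _ → refl)))
count-singleton {suc m} (fsuc y) =
  trans (count-suc {m} (λ u → does (u ≟ fsuc y))) (count-singleton y)

count-+ : ∀ {m} (g h k : Fin m → Bool) → (∀ u → indicator (g u) ≡ indicator (h u) + indicator (k u)) →
          count g ≡ count h + count k
count-+ {zero}  g h k split = refl
count-+ {suc m} g h k split = begin
  count g                             ≡⟨ count-suc g ⟩
  indicator (g 0F) + count (g ∘ fsuc) ≡⟨ cong₂ _+_ (split 0F) (count-+ _ _ _ (split ∘ fsuc)) ⟩
  (h₀ + k₀) + (count h′ + count k′)   ≡⟨ interchange h₀ k₀ (count h′) (count k′) ⟩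
  (h₀ + count h′) + (k₀ + count k′)   ≡⟨ cong₂ _+_ (count-suc h) (count-suc k) ⟨
  count h + count k                   ∎
  where
  open ≡-Reasoning
  h₀ k₀ : ℕ
  h₀ = indicator (h 0F)
  k₀ = indicator (k 0F)
  h′ k′ : Fin m → Bool
  h′ = h ∘ fsuc
  k′ = k ∘ fsuc

count-pair : ∀ {m} (g : Fin m → Bool) {y z} → y ≢ z → (∀ u → g u ≡ true → u ≢ y → u ≡ z) →
             g y ≡ true → g z ≡ true → count g ≡ 2
count-pair g {y} {z} y≢z only gy gz =
  trans (count-+ g (λ u → does (u ≟ y)) (λ u → does (u ≟ z)) split)
        (cong₂ _+_ (count-singleton y) (count-singleton z))
  where
  split : ∀ u → indicator (g u) ≡ indicator (does (u ≟ y)) + indicator (does (u ≟ z))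
  split u with u ≟ y | u ≟ z
  ... | yes refl | yes refl = ⊥-elim (y≢z refl)
  ... | yes refl | no _     = cong indicator gy
  ... | no _     | yes refl = cong indicator gz
  ... | no u≢y   | no u≢z   = cong indicator (Bool.¬-not (λ gu → u≢z (only u gu u≢y)))

data Transposed {n} (i j : Fin n) : Fin n → Fin n → Set where
  at-i      : Transposed i j i j
  at-j      : j ≢ i → Transposed i j j i
  elsewhere : ∀ {k} → k ≢ i → k ≢ j → Transposed i j k k

transposed : ∀ {n} (i j k : Fin n) → Transposed i j k (PC.transpose i j k)
transposed i j k with k ≟ i
... | yes refl = at-i
... | no k≢i with k ≟ j
...   | yes refl = at-j k≢i
...   | no k≢j   = elsewhere k≢i k≢j

module _ {n : ℕ} (i j : Fin n) where
  private
    τ : Fin n → Fin n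
    τ = PC.transpose i j

  transpose-matchˡ : τ i ≡ j
  transpose-matchˡ with τ i | transposed i j i
  ... | _ | at-i            = refl
  ... | _ | at-j _          = refl
  ... | _ | elsewhere i≢i _ = ⊥-elim (i≢i refl)

  transpose-matchʳ : τ j ≡ i
  transpose-matchʳ with τ j | transposed i j j
  ... | _ | at-i            = refl
  ... | _ | at-j _          = refl
  ... | _ | elsewhere _ j≢j = ⊥-elim (j≢j refl)

  transpose-fixed : ∀ {k} → k ≢ i → k ≢ j → τ k ≡ k
  transpose-fixed {k} k≢i k≢j with τ k | transposed i j k
  ... | _ | at-i          = ⊥-elim (k≢i refl)
  ... | _ | at-j _        = ⊥-elim (k≢j refl)
  ... | _ | elsewhere _ _ = refl

  transpose-involutive : ∀ k → τ (τ k) ≡ k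
  transpose-involutive k with τ k | transposed i j k
  ... | _ | at-i              = transpose-matchʳ
  ... | _ | at-j _            = transpose-matchˡ
  ... | _ | elsewhere k≢i k≢j = transpose-fixed k≢i k≢j

inject≤-inject₁ : ∀ {m n} (i : Fin m) .(m<n : suc m ≤ suc n) →
                  inject≤ (inject₁ i) m<n ≡ inject₁ (inject≤ i (s≤s⁻¹ m<n))
inject≤-inject₁ i m<n = toℕ-injective (begin
  toℕ (inject≤ (inject₁ i) m<n)        ≡⟨ toℕ-inject≤ (inject₁ i) m<n ⟩
  toℕ (inject₁ i)                      ≡⟨ toℕ-inject₁ i ⟩
  toℕ i                                ≡⟨ toℕ-inject≤ i (s≤s⁻¹ m<n) ⟨
  toℕ (inject≤ i (s≤s⁻¹ m<n))          ≡⟨ toℕ-inject₁ (inject≤ i (s≤s⁻¹ m<n)) ⟨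
  toℕ (inject₁ (inject≤ i (s≤s⁻¹ m<n))) ∎)
  where open ≡-Reasoning

inject≤-fromℕ-toℕ : ∀ {n} (i : Fin n) .(i<n : suc (toℕ i) ≤ n) → inject≤ (fromℕ (toℕ i)) i<n ≡ i
inject≤-fromℕ-toℕ i i<n =
  toℕ-injective (trans (toℕ-inject≤ (fromℕ (toℕ i)) i<n) (toℕ-fromℕ (toℕ i)))

opposite-inject₁ : ∀ {n} (i : Fin n) → opposite (inject₁ i) ≡ fsuc (opposite i)
opposite-inject₁ {suc n} 0F       = refl
opposite-inject₁ {suc n} (fsuc i) = cong inject₁ (opposite-inject₁ i)

opposite-injective : ∀ {n} → Injective _≡_ _≡_ (opposite {n})
opposite-injective {_} {i} {j} eq =
  trans (sym (opposite-involutive i)) (trans (cong opposite eq) (opposite-involutive j))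

module _ {n : ℕ} (G : Graph n) where

  infix 4 _~_ _~?_

  _~_ : Fin n → Fin n → Set
  u ~ v = adj G u v ≡ true

  _~?_ : ∀ u v → Dec (u ~ v)
  u ~? v = adj G u v Bool.≟ true

  ~-sym : ∀ {u v} → u ~ v → v ~ u
  ~-sym {u} {v} u~v = trans (Graph.sym G v u) u~v

  ~-irrefl : ∀ {u v} → u ~ v → u ≢ v
  ~-irrefl {u} u~u refl with () ← trans (sym u~u) (loopless G u)

  isolated-even : ∀ {v} → (∀ u → adj G v u ≡ false) → EvenDegree G v
  isolated-even {v} isolated = cong (_% 2) (count-none (adj G v) isolated)

  two-neighbours-even : ∀ {x y z} → y ≢ z → (∀ u → x ~ u → u ≢ y → u ≡ z) → x ~ y → x ~ z →
                        EvenDegree G x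
  two-neighbours-even {x} y≢z only x~y x~z =
    cong (_% 2) (count-pair (adj G x) y≢z only x~y x~z)

  transpose-automorphism : ∀ {a b} → (∀ w → w ≢ a → w ≢ b → adj G a w ≡ adj G b w) →
                           IsAutomorphism G (transpose a b)
  transpose-automorphism {a} {b} twins u v
    with PC.transpose a b u | transposed a b u | PC.transpose a b v | transposed a b v
  ... | _ | at-i              | _ | at-i              = trans (loopless G b) (sym (loopless G a))
  ... | _ | at-i              | _ | at-j _            = Graph.sym G b a
  ... | _ | at-i              | _ | elsewhere v≢a v≢b = sym (twins v v≢a v≢b)
  ... | _ | at-j _            | _ | at-i              = Graph.sym G a b
  ... | _ | at-j _            | _ | at-j _            = trans (loopless G a) (sym (loopless G b))
  ... | _ | at-j _            | _ | elsewhere v≢a v≢b = twins v v≢a v≢b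
  ... | _ | elsewhere u≢a u≢b | _ | at-i              =
    trans (Graph.sym G u b) (trans (sym (twins u u≢a u≢b)) (Graph.sym G a u))
  ... | _ | elsewhere u≢a u≢b | _ | at-j _            =
    trans (Graph.sym G u a) (trans (twins u u≢a u≢b) (Graph.sym G b u))
  ... | _ | elsewhere _ _     | _ | elsewhere _ _     = refl

  transpose-involution : ∀ {a b} → a ≢ b → (∀ w → w ≢ a → w ≢ b → adj G a w ≡ adj G b w) →
                         IsInvolution G (transpose a b)
  transpose-involution {a} {b} a≢b twins =
    transpose-automorphism twins ,
    transpose-involutive a b ,
    (a , λ a↦a → a≢b (trans (sym a↦a) (transpose-matchˡ a b)))

  LeafAt : Fin n → Fin n → Set
  LeafAt u x = ∀ w → adj G u w ≡ does (w ≟ x)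

  leaf-at : ∀ {u x} → u ~ x → (∀ w → u ~ w → w ≡ x) → LeafAt u x
  leaf-at {u} {x} u~x only w with w ≟ x
  ... | yes refl = u~x
  ... | no w≢x   = Bool.¬-not (w≢x ∘ only w)

  twin-leaves-involution : ∀ {a b x} → a ≢ b → LeafAt a x → LeafAt b x →
                           IsInvolution G (transpose a b)
  twin-leaves-involution a≢b a-leaf b-leaf =
    transpose-involution a≢b (λ w _ _ → trans (a-leaf w) (sym (b-leaf w)))

  isolated-edge-involution : ∀ {a b} → a ~ b → LeafAt a b → LeafAt b a →
                             IsInvolution G (transpose a b)
  isolated-edge-involution {a} {b} a~b a-leaf b-leaf =
    transpose-involution (~-irrefl a~b) λ w w≢a w≢b → begin
      adj G a w     ≡⟨ a-leaf w ⟩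
      does (w ≟ b)  ≡⟨ dec-false (w ≟ b) w≢b ⟩
      false         ≡⟨ dec-false (w ≟ a) w≢a ⟨
      does (w ≟ a)  ≡⟨ b-leaf w ⟨
      adj G b w     ∎
    where open ≡-Reasoning

  LeafyExcept : Fin n → Fin n → Set
  LeafyExcept x y = ∀ u → x ~ u → u ≢ y → LeafAt u x

  leafy-even : InvolutionFree G → ∀ {x y z} → LeafyExcept x y → x ~ y → x ~ z → z ≢ y →
               EvenDegree G x
  leafy-even involution-free {x} {y} {z} leafy x~y x~z z≢y
    with any? (λ u → x ~? u ×-dec ¬? (u ≟ y) ×-dec ¬? (u ≟ z))
  ... | yes (u , x~u , u≢y , u≢z) = ⊥-elim (involution-free (transpose u z)
          (twin-leaves-involution u≢z (leafy u x~u u≢y) (leafy z x~z z≢y)))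
  ... | no ∄u = two-neighbours-even (z≢y ∘ sym) only-y-z x~y x~z
    where
    only-y-z : ∀ u → x ~ u → u ≢ y → u ≡ z
    only-y-z u x~u u≢y = decidable-stable (u ≟ z) (λ u≢z → ∄u (u , x~u , u≢y , u≢z))

  neighbour-or-even : ∀ u → (∃ λ v → u ~ v) ⊎ EvenDegree G u
  neighbour-or-even u with any? (u ~?_)
  ... | yes u~v = inj₁ u~v
  ... | no ∄v   = inj₂ (isolated-even (λ v → Bool.¬-not (∄v ∘ (v ,_))))

  record Path (k : ℕ) : Set where
    field
      vtx      : Fin (suc k) → Fin n
      distinct : Injective _≡_ _≡_ vtx
      step     : ∀ (i : Fin k) → vtx (inject₁ i) ~ vtx (fsuc i)
  open Path

  path-length< : ∀ {k} → Path k → k < n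
  path-length< P = injective⇒≤ (distinct P)

  first≢third : ∀ {k} (P : Path (suc (suc k))) → vtx P 0F ≢ vtx P 2F
  first≢third P v₀≡v₂ with () ← distinct P v₀≡v₂

  edge : ∀ {u v} → u ~ v → Path 1
  edge {u} {v} u~v = record { vtx = vtx′ ; distinct = distinct′ ; step = λ { 0F → u~v } }
    where
    vtx′ : Fin 2 → Fin n
    vtx′ 0F = u
    vtx′ 1F = v
    distinct′ : Injective _≡_ _≡_ vtx′
    distinct′ {0F} {0F} _   = refl
    distinct′ {0F} {1F} u≡v = ⊥-elim (~-irrefl u~v u≡v)
    distinct′ {1F} {0F} v≡u = ⊥-elim (~-irrefl u~v (sym v≡u))
    distinct′ {1F} {1F} _   = refl

  cons : ∀ {k} (P : Path k) u → u ~ vtx P 0F → (∀ i → vtx P i ≢ u) → Path (suc k)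
  cons {k} P u u~v₀ u∉P = record { vtx = vtx′ ; distinct = distinct′ ; step = step′ }
    where
    vtx′ : Fin (suc (suc k)) → Fin n
    vtx′ 0F       = u
    vtx′ (fsuc i) = vtx P i
    distinct′ : Injective _≡_ _≡_ vtx′
    distinct′ {0F}     {0F}     _  = refl
    distinct′ {0F}     {fsuc j} eq = ⊥-elim (u∉P j (sym eq))
    distinct′ {fsuc i} {0F}     eq = ⊥-elim (u∉P i eq)
    distinct′ {fsuc i} {fsuc j} eq = cong fsuc (distinct P eq)
    step′ : ∀ (i : Fin (suc k)) → vtx′ (inject₁ i) ~ vtx′ (fsuc i)
    step′ 0F       = u~v₀
    step′ (fsuc i) = step P i

  tail : ∀ {k} → Path (suc k) → Path k
  tail P = record
    { vtx = vtx P ∘ fsuc ; distinct = suc-injective ∘ distinct P ; step = step P ∘ fsuc }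

  reverse : ∀ {k} → Path k → Path k
  reverse P = record
    { vtx = vtx P ∘ opposite ; distinct = opposite-injective ∘ distinct P ; step = step′ }
    where
    step′ : ∀ i → vtx P (opposite (inject₁ i)) ~ vtx P (opposite (fsuc i))
    step′ i rewrite opposite-inject₁ i = ~-sym (step P (opposite i))

  prefix : ∀ {k} (P : Path k) (j : Fin (suc k)) → Path (toℕ j)
  prefix P j = record
    { vtx      = λ i → vtx P (inject≤ i (toℕ<n j))
    ; distinct = λ eq → inject≤-injective _ _ _ _ (distinct P eq)
    ; step     = λ i → subst (_~ vtx P (fsuc (inject≤ i (s≤s⁻¹ (toℕ<n j)))))
                             (cong (vtx P) (sym (inject≤-inject₁ i (toℕ<n j))))
                             (step P (inject≤ i (s≤s⁻¹ (toℕ<n j))))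
    }

  cycle : ∀ {k} (P : Path (suc (suc k))) → vtx P (fromℕ (suc (suc k))) ~ vtx P 0F → Cycle G
  cycle {k} P last~first =
    record { len-3 = k ; vtx = vtx P ; distinct = distinct P ; step = step P ; close = last~first }

  fresh-or-cycle : ∀ {k} (P : Path (suc k)) {u} → u ~ vtx P 0F → u ≢ vtx P 1F →
                   Cycle G ⊎ (∀ i → vtx P i ≢ u)
  fresh-or-cycle P {u} u~v₀ u≢v₁ with any? (λ i → vtx P i ≟ u)
  ... | no u∉P          = inj₂ (λ i vᵢ≡u → u∉P (i , vᵢ≡u))
  ... | yes (0F , refl) = ⊥-elim (~-irrefl u~v₀ refl)
  ... | yes (1F , refl) = ⊥-elim (u≢v₁ refl)
  ... | yes (j@(fsuc (fsuc _)) , refl) =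
    inj₁ (cycle (prefix P j)
                (subst (_~ vtx P 0F) (cong (vtx P) (sym (inject≤-fromℕ-toℕ j (toℕ<n j)))) u~v₀))

  extend-or-leaf : ∀ {k} (P : Path (suc k)) →
                   Cycle G ⊎ Path (suc (suc k)) ⊎ LeafAt (vtx P 0F) (vtx P 1F)
  extend-or-leaf P with any? (λ w → vtx P 0F ~? w ×-dec ¬? (w ≟ vtx P 1F))
  ... | no ∄w = inj₂ (inj₂ (leaf-at (step P 0F) only-v₁))
    where
    only-v₁ : ∀ w → vtx P 0F ~ w → w ≡ vtx P 1F
    only-v₁ w v₀~w = decidable-stable (w ≟ vtx P 1F) (λ w≢v₁ → ∄w (w , v₀~w , w≢v₁))
  ... | yes (w , v₀~w , w≢v₁) with fresh-or-cycle P (~-sym v₀~w) w≢v₁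
  ...   | inj₁ c   = inj₁ c
  ...   | inj₂ w∉P = inj₂ (inj₁ (cons P w (~-sym v₀~w) w∉P))

  LeafyStart : ∀ {k} → Path (suc (suc k)) → Set
  LeafyStart P = LeafyExcept (vtx P 1F) (vtx P 2F)

  -- A non-leaf neighbour u ≠ v₂ of v₁, with a neighbour w ≠ v₁, replaces v₀ by w u.
  lengthen-or-leafy : ∀ {k} (P : Path (suc (suc k))) →
                      Cycle G ⊎ Path (suc (suc (suc k))) ⊎ LeafyStart P
  lengthen-or-leafy P with any? (λ u → any? (λ w →
    vtx P 1F ~? u ×-dec ¬? (u ≟ vtx P 2F) ×-dec u ~? w ×-dec ¬? (w ≟ vtx P 1F)))
  ... | no ∄uw = inj₂ (inj₂ λ u v₁~u u≢v₂ → leaf-at (~-sym v₁~u) (only-v₁ u v₁~u u≢v₂))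
    where
    only-v₁ : ∀ u → vtx P 1F ~ u → u ≢ vtx P 2F → ∀ w → u ~ w → w ≡ vtx P 1F
    only-v₁ u v₁~u u≢v₂ w u~w =
      decidable-stable (w ≟ vtx P 1F) (λ w≢v₁ → ∄uw (u , w , v₁~u , u≢v₂ , u~w , w≢v₁))
  ... | yes (u , w , v₁~u , u≢v₂ , u~w , w≢v₁) with fresh-or-cycle (tail P) (~-sym v₁~u) u≢v₂
  ...   | inj₁ c   = inj₁ c
  ...   | inj₂ u∉P with fresh-or-cycle (cons (tail P) u (~-sym v₁~u) u∉P) (~-sym u~w) w≢v₁
  ...     | inj₁ c    = inj₁ c
  ...     | inj₂ w∉P′ = inj₂ (inj₁ (cons (cons (tail P) u (~-sym v₁~u) u∉P) w (~-sym u~w) w∉P′))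

  record LeafyPath : Set where
    field
      {len}       : ℕ
      path        : Path (suc (suc len))
      leafy-start : LeafyStart path
      leafy-end   : LeafyStart (reverse path)

  leafy-path-or-cycle : ∀ fuel {k} (P : Path (suc (suc k))) → n ≤ fuel + suc (suc k) →
                        Cycle G ⊎ LeafyPath
  leafy-path-or-cycle zero       P n≤k = ⊥-elim (≤⇒≯ n≤k (path-length< P))
  leafy-path-or-cycle (suc fuel) {k} P n≤fuel+k with lengthen-or-leafy P
  ... | inj₁ c                  = inj₁ c
  ... | inj₂ (inj₁ P′)          =
    leafy-path-or-cycle fuel P′ (subst (n ≤_) (sym (+-suc fuel (suc (suc k)))) n≤fuel+k)
  ... | inj₂ (inj₂ leafy-start) with lengthen-or-leafy (reverse P)
  ...   | inj₁ c                = inj₁ c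
  ...   | inj₂ (inj₁ P′)        =
    leafy-path-or-cycle fuel P′ (subst (n ≤_) (sym (+-suc fuel (suc (suc k)))) n≤fuel+k)
  ...   | inj₂ (inj₂ leafy-end) =
    inj₂ record { path = P ; leafy-start = leafy-start ; leafy-end = leafy-end }

  AtMostOneEven : Set
  AtMostOneEven = ∀ u v → EvenDegree G u → EvenDegree G v → u ≡ v

  module _ (involution-free : InvolutionFree G) (at-most-one-even : AtMostOneEven) where

    leafy-start-even : ∀ {k} (P : Path (suc (suc k))) → LeafyStart P → EvenDegree G (vtx P 1F)
    leafy-start-even P leafy =
      leafy-even involution-free leafy (step P 1F) (~-sym (step P 0F)) (first≢third P)

    no-leafy-path : LeafyPath → ⊥
    no-leafy-path record { len = 0 ; path = P ; leafy-start = start ; leafy-end = end } =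
      involution-free (transpose (vtx P 0F) (vtx P 2F))
        (twin-leaves-involution (first≢third P) (start (vtx P 0F) (~-sym (step P 0F)) (first≢third P))
                                                (end (vtx P 2F) (step P 1F) (first≢third P ∘ sym)))
    -- The second vertices from either end sit at the distinct positions 1 and 2 + len, and both are even.
    no-leafy-path record { len = suc _ ; path = P ; leafy-start = start ; leafy-end = end }
      with () ← distinct P (at-most-one-even _ _ (leafy-start-even P start)
                                                 (leafy-start-even (reverse P) end))

    cycle-from-path : ∀ {k} → Path (suc (suc k)) → Cycle G
    cycle-from-path {k} P with leafy-path-or-cycle n P (m≤m+n n (suc (suc k)))
    ... | inj₁ c = c
    ... | inj₂ L = ⊥-elim (no-leafy-path L)

    cycle-from-edge : ∀ {r c} → r ~ c → Cycle G
    cycle-from-edge r~c with extend-or-leaf (edge r~c)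
    ... | inj₁ c         = c
    ... | inj₂ (inj₁ P)  = cycle-from-path P
    ... | inj₂ (inj₂ r-leaf) with extend-or-leaf (reverse (edge r~c))
    ...   | inj₁ c             = c
    ...   | inj₂ (inj₁ P)      = cycle-from-path P
    ...   | inj₂ (inj₂ c-leaf) =
      ⊥-elim (involution-free (transpose _ _) (isolated-edge-involution r~c r-leaf c-leaf))

lemma5p1 : (n : ℕ) (G : Graph n) → InvolutionFree G → 2 ≤ n
           → (∀ u v → EvenDegree G u → EvenDegree G v → u ≡ v)
           → HasCycle G
lemma5p1 _ G involution-free (s≤s (s≤s _)) at-most-one-even
  with neighbour-or-even G 0F | neighbour-or-even G 1F
... | inj₁ (_ , 0~v) | _              = cycle-from-edge G involution-free at-most-one-even 0~v
... | _              | inj₁ (_ , 1~v) = cycle-from-edge G involution-free at-most-one-even 1~v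
... | inj₂ even₀     | inj₂ even₁     with () ← at-most-one-even 0F 1F even₀ even₁
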